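{- Let $K$ be a field of characteristic zero and let $f\in K[[x]]$ be a compositionally invertible formal power series with $f\neq \mathrm{id}$, and write $f_n=D^n(f)(0)$, so that $f(x)=\sum_{n\ge1} f_n\frac{x^n}{n!}$. Then $f$ is involutory (i.e. $f\circ f=\mathrm{id}$) if and only if there is a sequence of constants $a_1,a_2,a_3,\ldots\in K$ such that for every $n\geq 1$ \[ f_n=\begin{cases} -1, & \text{if } n=1;\\ a_{n/2}, & \text{if } n \text{ is even};\\ \frac12\sum_{k=2}^{n-1} f_k\,B_{n,k}(-1,f_2,\ldots,f_{n-k+1}), & \text{if } n\ge 3 \text{ is odd}.\end{cases} \]
   Context: Functions are formal power series over a fixed field $K$ of characteristic zero. A series $f\in K[[x]]$ is (compositionally) invertible iff $f(0)=0$ and $f'(0)\neq0$; the invertible series form a group under composition $\circ$, with identity $\mathrm{id}(x)=x$. $D$ denotes formal differentiation on $K[[x]]$ and $D^n$ its $n$-th iterate, so $D^n(f)(0)$ is the $n$-th Taylor coefficient $n!\,[x^n]f$. $B_{n,k}$ denotes the partial (exponential) Bell polynomial $B_{n,k}(X_1,\ldots,X_{n-k+1})=\sum \frac{n!}{k_1!k_2!\cdots}\prod_{j\ge1}\left(\frac{X_j}{j!}\right)^{k_j}$, the sum over all nonnegative integers $k_1,k_2,\ldots$ with $\sum_j k_j=k$ and $\sum_j jk_j=n$. -}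

module Defs where

open import Level using (Level; _⊔_) renaming (suc to lsuc)
open import Data.Nat as ℕ using (ℕ; zero; suc; _∸_; _!; _≡ᵇ_)
open import Data.Bool using (Bool; true; false; if_then_else_; _∧_)
open import Data.List using (List; []; _∷_; [_]; map; concatMap; upTo)
import Data.Nat.ListAction as ListAction
open import Relation.Nullary using (¬_)
open import Algebra.Bundles using (CommutativeRing)

ringFromℕ : {c ℓ : Level} (R : CommutativeRing c ℓ) → ℕ → CommutativeRing.Carrier R
ringFromℕ R zero    = CommutativeRing.0# R
ringFromℕ R (suc n) = CommutativeRing._+_ R (CommutativeRing.1# R) (ringFromℕ R n)

-- A field of characteristic zero: a commutative ring (with setoid equality ≈)
-- in which every nonzero element has a multiplicative inverse, and
-- n·1 ≠ 0 for every n ≥ 1 (which in particular gives 1 ≠ 0).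
record CharZeroField (c ℓ : Level) : Set (lsuc (c ⊔ ℓ)) where
  field
    commutativeRing : CommutativeRing c ℓ
  open CommutativeRing commutativeRing public
  field
    _⁻¹       : Carrier → Carrier
    inverseʳ  : ∀ x → ¬ (x ≈ 0#) → (x * (x ⁻¹)) ≈ 1#
    charZero  : ∀ n → ¬ (ringFromℕ commutativeRing (suc n) ≈ 0#)

  fromℕ : ℕ → Carrier
  fromℕ = ringFromℕ commutativeRing

-- Formal power series over K, represented by their (ordinary) coefficient
-- sequences: f ↦ (n ↦ [xⁿ] f).
module PowerSeries {c ℓ : Level} (K : CharZeroField c ℓ) where
  open CharZeroField K hiding (zero)

  Series : Set c
  Series = ℕ → Carrier

  _≋_ : Series → Series → Set ℓ
  f ≋ g = ∀ n → f n ≈ g n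

  sumTo : ℕ → (ℕ → Carrier) → Carrier
  sumTo zero    g = 0#
  sumTo (suc n) g = sumTo n g + g n

  -- Σ_{i=a}^{b} g i  (empty if b < a)
  sumFromTo : ℕ → ℕ → (ℕ → Carrier) → Carrier
  sumFromTo a b g = sumTo (suc b ∸ a) (λ i → g (a ℕ.+ i))

  sumList : List Carrier → Carrier
  sumList []       = 0#
  sumList (x ∷ xs) = x + sumList xs

  powK : Carrier → ℕ → Carrier
  powK x zero    = 1#
  powK x (suc k) = x * powK x k

  oneS : Series
  oneS zero    = 1#
  oneS (suc _) = 0#

  idS : Series
  idS zero          = 0#
  idS (suc zero)    = 1#
  idS (suc (suc _)) = 0#

  _·_ : Series → Series → Series
  (f · g) n = sumTo (suc n) (λ i → f i * g (n ∸ i))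

  powS : Series → ℕ → Series
  powS f zero    = oneS
  powS f (suc k) = f · powS f k

  -- composition g ∘ f = Σ_k g_k f^k  (well defined since f(0) = 0 for the
  -- series it is applied to: only k ≤ n contributes to [xⁿ])
  _∘ₛ_ : Series → Series → Series
  (g ∘ₛ f) n = sumTo (suc n) (λ k → g k * powS f k n)

  D : Series → Series
  D f n = fromℕ (suc n) * f (suc n)

  D^ : ℕ → Series → Series
  D^ zero    f = f
  D^ (suc n) f = D (D^ n f)

  -- the n-th Taylor coefficient Dⁿ(f)(0) = n! [xⁿ] f
  taylor : ℕ → Series → Carrier
  taylor n f = D^ n f 0

  Invertible : Series → Set ℓ
  Invertible f = (f 0 ≈ 0#) × ¬ (taylor 1 f ≈ 0#)
    where open import Data.Product using (_×_)

  -- Partial exponential Bell polynomial B_{n,k}(X_1,…,X_{n-k+1}),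
  -- the arguments given as a sequence X (only X_1..X_{n-k+1} are used):
  --   Σ n!/(k_1! k_2! ⋯) ∏_j (X_j / j!)^{k_j}
  -- summed over tuples (k_1,…,k_{n-k+1}) of naturals with Σ k_j = k and
  -- Σ j k_j = n (every such tuple has entries ≤ n, so we enumerate those).

  allTuples : ℕ → ℕ → List (List ℕ)
  allTuples zero    b = [ [] ]
  allTuples (suc m) b =
    concatMap (λ t → map (λ x → x ∷ t) (upTo (suc b))) (allTuples m b)

  weightFrom : ℕ → List ℕ → ℕ
  weightFrom j []       = 0
  weightFrom j (x ∷ ks) = j ℕ.* x ℕ.+ weightFrom (suc j) ks

  termFrom : (ℕ → Carrier) → ℕ → List ℕ → Carrier
  termFrom X j []       = 1#
  termFrom X j (x ∷ ks) =
    ((fromℕ (x !)) ⁻¹ * powK (X j * (fromℕ (j !)) ⁻¹) x) * termFrom X (suc j) ks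

  Bell : ℕ → ℕ → (ℕ → Carrier) → Carrier
  Bell n k X = sumList (map summand (allTuples (suc (n ∸ k)) n))
    where
    summand : List ℕ → Carrier
    summand ks =
      if (ListAction.sum ks ≡ᵇ k) ∧ (weightFrom 1 ks ≡ᵇ n)
      then fromℕ (n !) * termFrom X 1 ks
      else 0#

  argSeq : Series → ℕ → Carrier
  argSeq f zero          = taylor zero f
  argSeq f (suc zero)    = - 1#
  argSeq f (suc (suc j)) = taylor (suc (suc j)) f

  half : Carrier
  half = (1# + 1#) ⁻¹

{-# OPTIONS --safe #-}
-- Write f = Σ aₙ xⁿ with a₀ = 0. For n ≥ 2 the coefficient of xⁿ in f ∘ f is
-- a₁aₙ + Σ_{2≤k<n} a_k [xⁿ]fᵏ + aₙa₁ⁿ, and since B_{n,k}(X) = (n!/k!) [xⁿ](Σ_j X_j xʲ/j!)ᵏ,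
-- the odd-degree formula says exactly that this coefficient vanishes when a₁ = -1 and n is odd.
-- An involution has a₁² = 1, and a₁ = 1 would force f = id degree by degree; so a₁ = -1.
-- Conversely the formula gives f ∘ f = id in odd degrees, and if f ∘ f = x + c xⁿ + ⋯ with n
-- even, comparing f ∘ (f ∘ f) with (f ∘ f) ∘ f in degree n gives -c = c.
module Submission where

open import Defs
open import Level using (Level; _⊔_)
open import Data.Nat as ℕ using (ℕ; zero; suc; _≤_; _<_; _∸_; z≤n; s≤s; _!; _≡ᵇ_)
import Data.Nat.Properties as ℕₚ
import Data.Nat.ListAction as ListAction
open import Data.Nat.Combinatorics using (_C_; k![n∸k]!∣n!)
open import Data.Nat.Combinatorics.Specification using (nCk≡n!/k![n-k]!)
open import Data.Nat.DivMod using (m/n*n≡m)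
open import Data.Nat.Induction using (<-rec)
open import Data.Bool using (Bool; true; false; if_then_else_; _∧_)
open import Data.List using (List; []; _∷_; map; concatMap; upTo; applyUpTo; _++_)
open import Data.List.Properties using (map-∘)
open import Data.Fin using (toℕ)
open import Data.Product using (_×_; Σ; ∃; _,_)
open import Data.Sum using (_⊎_; inj₁; inj₂)
open import Data.Empty using (⊥-elim)
open import Function using (_⇔_; mk⇔; Equivalence)
open import Function.Properties.Equivalence using () renaming (trans to ⇔-trans)
open import Relation.Binary.PropositionalEquality as ≡ using (_≡_; _≢_)
open import Relation.Nullary using (¬_; yes; no)
open import Relation.Binary.Structures using (IsEquivalence)
open import Algebra.Bundles using (CommutativeSemiring)
open import Algebra.Structures using (IsCommutativeMonoid)
open import Algebra.Structures.Biased using (isCommutativeSemiringˡ)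
import Algebra.Properties.CommutativeSemigroup as CommutativeSemigroupProperties
import Algebra.Properties.Ring as RingProperties
import Algebra.Properties.Group as GroupProperties

n≤m⇒m<n+o⇒m∸n<o : ∀ m n o → n ≤ m → m < n ℕ.+ o → m ∸ n < o
n≤m⇒m<n+o⇒m∸n<o m       zero    o _         m<o      = m<o
n≤m⇒m<n+o⇒m∸n<o (suc m) (suc n) o (s≤s n≤m) (s≤s lt) = n≤m⇒m<n+o⇒m∸n<o m n o n≤m lt

nCk*[k!*[n∸k]!]≡n! : ∀ n k → k ≤ n → (n C k) ℕ.* (k ! ℕ.* (n ∸ k) !) ≡ n !
nCk*[k!*[n∸k]!]≡n! n k k≤n =
  ≡.trans (≡.cong (ℕ._* (k ! ℕ.* (n ∸ k) !)) (nCk≡n!/k![n-k]! k≤n))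
          (m/n*n≡m {{ℕₚ._!*_!≢0 k (n ∸ k)}} (k![n∸k]!∣n! k≤n))

+-≡ᵇ-≤ : ∀ x t s → x ≤ s → (x ℕ.+ t ≡ᵇ s) ≡ (t ≡ᵇ s ∸ x)
+-≡ᵇ-≤ zero    t s       _         = ≡.refl
+-≡ᵇ-≤ (suc x) t (suc s) (s≤s x≤s) = +-≡ᵇ-≤ x t s x≤s

+-≡ᵇ-> : ∀ x t s → s < x → (x ℕ.+ t ≡ᵇ s) ≡ false
+-≡ᵇ-> (suc x) t zero    _        = ≡.refl
+-≡ᵇ-> (suc x) t (suc s) (s≤s s<x) = +-≡ᵇ-> x t s s<x

even⊎odd : ∀ n → ∃ (λ k → n ≡ 2 ℕ.* k) ⊎ ∃ (λ k → n ≡ suc (2 ℕ.* k))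
even⊎odd zero = inj₁ (0 , ≡.refl)
even⊎odd (suc n) with even⊎odd n
... | inj₁ (k , ≡.refl) = inj₂ (k , ≡.refl)
... | inj₂ (k , ≡.refl) = inj₁ (suc k , ≡.sym (ℕₚ.*-suc 2 k))

2[1+k]+1≡3+2k : ∀ k → 2 ℕ.* suc k ℕ.+ 1 ≡ 3 ℕ.+ 2 ℕ.* k
2[1+k]+1≡3+2k k = ≡.trans (≡.cong (ℕ._+ 1) (ℕₚ.*-suc 2 k)) (ℕₚ.+-comm (2 ℕ.+ 2 ℕ.* k) 1)

module CharZeroFieldProperties {c ℓ : Level} (K : CharZeroField c ℓ) where
  open CharZeroField K hiding (zero)
  open PowerSeries K
  open import Relation.Binary.Reasoning.Setoid setoid
  open RingProperties ring using (-1*x≈-x; -‿distribʳ-*)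
  open GroupProperties +-group using (x∙y⁻¹≈ε⇒x≈y; x≈y⇒x∙y⁻¹≈ε; inverseˡ-unique)
  open CommutativeSemigroupProperties *-commutativeSemigroup using (x∙yz≈y∙xz)

  ≈-resp-⇔ : ∀ {x x′ y y′} → x ≈ x′ → y ≈ y′ → (x ≈ y) ⇔ (x′ ≈ y′)
  ≈-resp-⇔ x≈x′ y≈y′ =
    mk⇔ (λ x≈y → trans (sym x≈x′) (trans x≈y y≈y′)) (λ x′≈y′ → trans x≈x′ (trans x′≈y′ (sym y≈y′)))

  x-y≈0⇔x≈y : ∀ x y → (x + - y ≈ 0#) ⇔ (x ≈ y)
  x-y≈0⇔x≈y x y = mk⇔ (x∙y⁻¹≈ε⇒x≈y x y) x≈y⇒x∙y⁻¹≈ε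

  x*y≈0⇒y≈0 : ∀ {x y} → ¬ (x ≈ 0#) → x * y ≈ 0# → y ≈ 0#
  x*y≈0⇒y≈0 {x} {y} x≉0 xy≈0 = begin
    y                ≈⟨ *-identityˡ y ⟨
    1# * y           ≈⟨ *-congʳ (trans (*-comm _ _) (inverseʳ x x≉0)) ⟨
    (x ⁻¹ * x) * y   ≈⟨ *-assoc _ _ _ ⟩
    x ⁻¹ * (x * y)   ≈⟨ *-congˡ xy≈0 ⟩
    x ⁻¹ * 0#        ≈⟨ zeroʳ _ ⟩
    0#               ∎

  *-cancelˡ-⇔ : ∀ {a x y} → ¬ (a ≈ 0#) → (x ≈ y) ⇔ (a * x ≈ a * y)
  *-cancelˡ-⇔ {a} {x} {y} a≉0 = mk⇔ *-congˡ cancel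
    where
    cancel : a * x ≈ a * y → x ≈ y
    cancel ax≈ay = x∙y⁻¹≈ε⇒x≈y x y (x*y≈0⇒y≈0 a≉0 (begin
      a * (x + - y)        ≈⟨ distribˡ a x (- y) ⟩
      a * x + a * - y      ≈⟨ +-congˡ (-‿distribʳ-* a y) ⟨
      a * x + - (a * y)    ≈⟨ +-congʳ ax≈ay ⟩
      a * y + - (a * y)    ≈⟨ -‿inverseʳ _ ⟩
      0#                   ∎))

  2≉0 : ¬ (1# + 1# ≈ 0#)
  2≉0 2≈0 = charZero 1 (trans (+-congˡ (+-identityʳ 1#)) 2≈0)

  2*x≈x+x : ∀ x → (1# + 1#) * x ≈ x + x
  2*x≈x+x x = trans (distribʳ _ _ _) (+-cong (*-identityˡ x) (*-identityˡ x))

  x+x≈0⇒x≈0 : ∀ {x} → x + x ≈ 0# → x ≈ 0#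
  x+x≈0⇒x≈0 x+x≈0 = x*y≈0⇒y≈0 2≉0 (trans (2*x≈x+x _) x+x≈0)

  -x≈x⇒x≈0 : ∀ {x} → - x ≈ x → x ≈ 0#
  -x≈x⇒x≈0 {x} -x≈x = x+x≈0⇒x≈0 (trans (+-congˡ (sym -x≈x)) (-‿inverseʳ x))

  y≈x+x⇔x≈half*y : ∀ x y → (y ≈ x + x) ⇔ (x ≈ half * y)
  y≈x+x⇔x≈half*y x y = mk⇔
    (λ y≈x+x → sym (trans (*-congˡ (trans y≈x+x (sym (2*x≈x+x x)))) half*2*z≈z))
    (λ x≈half*y → sym (trans (sym (2*x≈x+x x))
       (trans (*-congˡ x≈half*y) (trans (x∙yz≈y∙xz _ _ _) half*2*z≈z))))
    where
    half*2*z≈z : ∀ {z} → half * ((1# + 1#) * z) ≈ z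
    half*2*z≈z {z} = trans (sym (*-assoc _ _ _))
      (trans (*-congʳ (trans (*-comm _ _) (inverseʳ _ 2≉0))) (*-identityˡ z))

  x*x≈1∧x≉1⇒x≈-1 : ∀ {x} → x * x ≈ 1# → ¬ (x ≈ 1#) → x ≈ - 1#
  x*x≈1∧x≉1⇒x≈-1 {x} x*x≈1 x≉1 = inverseˡ-unique x 1#
    (x*y≈0⇒y≈0 (λ x-1≈0 → x≉1 (x∙y⁻¹≈ε⇒x≈y x 1# x-1≈0)) (begin
      (x + - 1#) * (x + 1#)               ≈⟨ distribʳ _ _ _ ⟩
      x * (x + 1#) + - 1# * (x + 1#)      ≈⟨ +-cong (distribˡ _ _ _) (-1*x≈-x _) ⟩
      (x * x + x * 1#) + - (x + 1#)       ≈⟨ +-congʳ (trans (+-cong x*x≈1 (*-identityʳ x)) (+-comm _ _)) ⟩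
      (x + 1#) + - (x + 1#)               ≈⟨ -‿inverseʳ _ ⟩
      0#                                  ∎))

  -1*-1≈1 : - 1# * - 1# ≈ 1#
  -1*-1≈1 = trans (-1*x≈-x (- 1#)) (GroupProperties.⁻¹-involutive +-group 1#)

  powK-1 : ∀ {x} → x ≈ 1# → ∀ n → powK x n ≈ 1#
  powK-1 x≈1 zero    = refl
  powK-1 x≈1 (suc n) = trans (*-cong x≈1 (powK-1 x≈1 n)) (*-identityˡ 1#)

  powK-2+ : ∀ {x} → x * x ≈ 1# → ∀ n → powK x (2 ℕ.+ n) ≈ powK x n
  powK-2+ {x} x*x≈1 n = trans (sym (*-assoc x x _)) (trans (*-congʳ x*x≈1) (*-identityˡ _))

  powK-even : ∀ {x} → x * x ≈ 1# → ∀ k → powK x (2 ℕ.* k) ≈ 1#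
  powK-even {x} x*x≈1 zero    = refl
  powK-even {x} x*x≈1 (suc k) =
    trans (reflexive (≡.cong (powK x) (ℕₚ.*-suc 2 k)))
          (trans (powK-2+ x*x≈1 (2 ℕ.* k)) (powK-even x*x≈1 k))

  powK-odd : ∀ {x} → x * x ≈ 1# → ∀ k → powK x (suc (2 ℕ.* k)) ≈ x
  powK-odd {x} x*x≈1 k = trans (*-congˡ (powK-even x*x≈1 k)) (*-identityʳ x)

  fromℕ-+ : ∀ a b → fromℕ (a ℕ.+ b) ≈ fromℕ a + fromℕ b
  fromℕ-+ zero    b = sym (+-identityˡ _)
  fromℕ-+ (suc a) b = trans (+-congˡ (fromℕ-+ a b)) (sym (+-assoc _ _ _))

  fromℕ-* : ∀ a b → fromℕ (a ℕ.* b) ≈ fromℕ a * fromℕ b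
  fromℕ-* zero    b = sym (zeroˡ _)
  fromℕ-* (suc a) b = begin
    fromℕ (b ℕ.+ a ℕ.* b)        ≈⟨ fromℕ-+ b (a ℕ.* b) ⟩
    fromℕ b + fromℕ (a ℕ.* b)    ≈⟨ +-cong (*-identityˡ _) (sym (fromℕ-* a b)) ⟨
    1# * fromℕ b + fromℕ a * fromℕ b ≈⟨ distribʳ _ _ _ ⟨
    fromℕ (suc a) * fromℕ b      ∎

  n!≉0 : ∀ n → ¬ (fromℕ (n !) ≈ 0#)
  n!≉0 n with n ! | ℕₚ.1≤n! n
  ... | suc m | _ = charZero m

  n!*n!⁻¹≈1 : ∀ n → fromℕ (n !) * fromℕ (n !) ⁻¹ ≈ 1#
  n!*n!⁻¹≈1 n = inverseʳ _ (n!≉0 n)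

  n!*k!⁻¹≈nCk*[n∸k]! : ∀ n k → k ≤ n → fromℕ (n !) * fromℕ (k !) ⁻¹ ≈ fromℕ (n C k) * fromℕ ((n ∸ k) !)
  n!*k!⁻¹≈nCk*[n∸k]! n k k≤n = sym (begin
    γ                                                       ≈⟨ *-identityʳ γ ⟨
    γ * 1#                                                  ≈⟨ *-congˡ (n!*n!⁻¹≈1 k) ⟨
    γ * (fromℕ (k !) * k!⁻¹)                                ≈⟨ *-assoc _ _ _ ⟨
    (fromℕ (n C k) * fromℕ ((n ∸ k) !) * fromℕ (k !)) * k!⁻¹ ≈⟨ *-congʳ (*-assoc _ _ _) ⟩
    (fromℕ (n C k) * (fromℕ ((n ∸ k) !) * fromℕ (k !))) * k!⁻¹
      ≈⟨ *-congʳ (*-congˡ (trans (*-comm _ _) (sym (fromℕ-* (k !) ((n ∸ k) !))))) ⟩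
    (fromℕ (n C k) * fromℕ (k ! ℕ.* (n ∸ k) !)) * k!⁻¹       ≈⟨ *-congʳ (fromℕ-* (n C k) _) ⟨
    fromℕ ((n C k) ℕ.* (k ! ℕ.* (n ∸ k) !)) * k!⁻¹          ≈⟨ *-congʳ (reflexive (≡.cong fromℕ (nCk*[k!*[n∸k]!]≡n! n k k≤n))) ⟩
    fromℕ (n !) * k!⁻¹                                      ∎)
    where
    γ = fromℕ (n C k) * fromℕ ((n ∸ k) !)
    k!⁻¹ = fromℕ (k !) ⁻¹

  binomial-rescale : ∀ s x → x ≤ s → ∀ p q →
    fromℕ (s C x) * (p * (fromℕ ((s ∸ x) !) * q)) ≈ fromℕ (s !) * ((fromℕ (x !) ⁻¹ * p) * q)
  binomial-rescale s x x≤s p q = begin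
    fromℕ (s C x) * (p * (fromℕ ((s ∸ x) !) * q))   ≈⟨ *-congˡ (x∙yz≈y∙xz p _ q) ⟩
    fromℕ (s C x) * (fromℕ ((s ∸ x) !) * (p * q))   ≈⟨ *-assoc _ _ _ ⟨
    (fromℕ (s C x) * fromℕ ((s ∸ x) !)) * (p * q)   ≈⟨ *-congʳ (n!*k!⁻¹≈nCk*[n∸k]! s x x≤s) ⟨
    (fromℕ (s !) * fromℕ (x !) ⁻¹) * (p * q)        ≈⟨ *-assoc _ _ _ ⟩
    fromℕ (s !) * (fromℕ (x !) ⁻¹ * (p * q))        ≈⟨ *-congˡ (*-assoc _ _ _) ⟨
    fromℕ (s !) * ((fromℕ (x !) ⁻¹ * p) * q)        ∎

  D^-coefficient : ∀ n f i → fromℕ (i !) * D^ n f i ≈ fromℕ ((n ℕ.+ i) !) * f (n ℕ.+ i)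
  D^-coefficient zero    f i = refl
  D^-coefficient (suc n) f i = begin
    fromℕ (i !) * (fromℕ (suc i) * D^ n f (suc i))  ≈⟨ *-assoc _ _ _ ⟨
    (fromℕ (i !) * fromℕ (suc i)) * D^ n f (suc i)  ≈⟨ *-congʳ (trans (*-comm _ _) (sym (fromℕ-* (suc i) (i !)))) ⟩
    fromℕ (suc i !) * D^ n f (suc i)                ≈⟨ D^-coefficient n f (suc i) ⟩
    fromℕ ((n ℕ.+ suc i) !) * f (n ℕ.+ suc i)       ≈⟨ reflexive (≡.cong (λ m → fromℕ (m !) * f m) (ℕₚ.+-suc n i)) ⟩
    fromℕ ((suc n ℕ.+ i) !) * f (suc n ℕ.+ i)       ∎

  taylor≈n!*coefficient : ∀ n f → taylor n f ≈ fromℕ (n !) * f n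
  taylor≈n!*coefficient n f = begin
    D^ n f 0                        ≈⟨ *-identityˡ _ ⟨
    1# * D^ n f 0                   ≈⟨ *-congʳ (+-identityʳ 1#) ⟨
    fromℕ (0 !) * D^ n f 0          ≈⟨ D^-coefficient n f 0 ⟩
    fromℕ ((n ℕ.+ 0) !) * f (n ℕ.+ 0) ≈⟨ reflexive (≡.cong (λ m → fromℕ (m !) * f m) (ℕₚ.+-identityʳ n)) ⟩
    fromℕ (n !) * f n               ∎

module Sums {c ℓ : Level} (K : CharZeroField c ℓ) where
  open CharZeroField K hiding (zero)
  open PowerSeries K
  open import Relation.Binary.Reasoning.Setoid setoid
  open CommutativeSemigroupProperties +-commutativeSemigroup using ()
    renaming (interchange to +-interchange)

  sumTo-cong-< : ∀ n {g h : ℕ → Carrier} → (∀ i → i < n → g i ≈ h i) → sumTo n g ≈ sumTo n h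
  sumTo-cong-< zero    eq = refl
  sumTo-cong-< (suc n) eq =
    +-cong (sumTo-cong-< n (λ i i<n → eq i (ℕₚ.m<n⇒m<1+n i<n))) (eq n ℕₚ.≤-refl)

  sumTo-cong : ∀ n {g h : ℕ → Carrier} → (∀ i → g i ≈ h i) → sumTo n g ≈ sumTo n h
  sumTo-cong n eq = sumTo-cong-< n (λ i _ → eq i)

  sumTo-zero : ∀ n {g : ℕ → Carrier} → (∀ i → i < n → g i ≈ 0#) → sumTo n g ≈ 0#
  sumTo-zero zero    eq = refl
  sumTo-zero (suc n) eq =
    trans (+-cong (sumTo-zero n (λ i i<n → eq i (ℕₚ.m<n⇒m<1+n i<n))) (eq n ℕₚ.≤-refl))
          (+-identityˡ 0#)

  sumTo-distrib-+ : ∀ n (g h : ℕ → Carrier) →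
                    sumTo n (λ i → g i + h i) ≈ sumTo n g + sumTo n h
  sumTo-distrib-+ zero    g h = sym (+-identityˡ 0#)
  sumTo-distrib-+ (suc n) g h = trans (+-congʳ (sumTo-distrib-+ n g h)) (+-interchange _ _ _ _)

  *-distribˡ-sumTo : ∀ n x (g : ℕ → Carrier) → x * sumTo n g ≈ sumTo n (λ i → x * g i)
  *-distribˡ-sumTo zero    x g = zeroʳ x
  *-distribˡ-sumTo (suc n) x g = trans (distribˡ x _ _) (+-congʳ (*-distribˡ-sumTo n x g))

  *-distribʳ-sumTo : ∀ n x (g : ℕ → Carrier) → sumTo n g * x ≈ sumTo n (λ i → g i * x)
  *-distribʳ-sumTo n x g =
    trans (*-comm _ x) (trans (*-distribˡ-sumTo n x g) (sumTo-cong n (λ i → *-comm x (g i))))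

  sumTo-*-sumTo : ∀ m n (g h : ℕ → Carrier) →
                  sumTo m g * sumTo n h ≈ sumTo m (λ i → sumTo n (λ j → g i * h j))
  sumTo-*-sumTo m n g h =
    trans (*-distribʳ-sumTo m _ g) (sumTo-cong m (λ i → *-distribˡ-sumTo n (g i) h))

  sumTo-head : ∀ n (g : ℕ → Carrier) → sumTo (suc n) g ≈ g 0 + sumTo n (λ i → g (suc i))
  sumTo-head zero    g = trans (+-identityˡ _) (sym (+-identityʳ _))
  sumTo-head (suc n) g = trans (+-congʳ (sumTo-head n g)) (+-assoc _ _ _)

  sumTo-swap : ∀ m n (g : ℕ → ℕ → Carrier) →
    sumTo m (λ i → sumTo n (λ j → g i j)) ≈ sumTo n (λ j → sumTo m (λ i → g i j))
  sumTo-swap zero    n g = sym (sumTo-zero n (λ _ _ → refl))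
  sumTo-swap (suc m) n g = trans (+-congʳ (sumTo-swap m n g)) (sym (sumTo-distrib-+ n _ _))

  sumTo-single : ∀ n j {g : ℕ → Carrier} → j < n → (∀ i → i < n → i ≢ j → g i ≈ 0#) →
                 sumTo n g ≈ g j
  sumTo-single (suc n) j j<1+n eq with ℕₚ.m<1+n⇒m<n∨m≡n j<1+n
  ... | inj₁ j<n =
    trans (+-cong (sumTo-single n j j<n (λ i i<n → eq i (ℕₚ.m<n⇒m<1+n i<n)))
                  (eq n ℕₚ.≤-refl (λ n≡j → ℕₚ.<-irrefl (≡.sym n≡j) j<n)))
          (+-identityʳ _)
  ... | inj₂ ≡.refl =
    trans (+-congʳ (sumTo-zero n (λ i i<n → eq i (ℕₚ.m<n⇒m<1+n i<n) (ℕₚ.<⇒≢ i<n))))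
          (+-identityˡ _)

  sumTo-truncate : ∀ m N {g : ℕ → Carrier} → m ≤ N → (∀ i → m ≤ i → i < N → g i ≈ 0#) →
                   sumTo N g ≈ sumTo m g
  sumTo-truncate m zero    z≤n _ = refl
  sumTo-truncate m (suc N) m≤1+N eq with ℕₚ.m≤n⇒m<n∨m≡n m≤1+N
  ... | inj₂ ≡.refl = refl
  ... | inj₁ m<1+N =
    trans (+-cong (sumTo-truncate m N m≤N (λ i m≤i i<N → eq i m≤i (ℕₚ.m<n⇒m<1+n i<N)))
                  (eq N m≤N ℕₚ.≤-refl))
          (+-identityʳ _)
    where m≤N = ℕₚ.≤-pred m<1+N

  sumTo-reverse : ∀ n (g : ℕ → Carrier) → sumTo (suc n) g ≈ sumTo (suc n) (λ i → g (n ∸ i))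
  sumTo-reverse zero    g = refl
  sumTo-reverse (suc n) g = sym (begin
    sumTo (suc (suc n)) (λ i → g (suc n ∸ i))    ≈⟨ sumTo-head (suc n) _ ⟩
    g (suc n) + sumTo (suc n) (λ i → g (n ∸ i))  ≈⟨ +-congˡ (sumTo-reverse n g) ⟨
    g (suc n) + sumTo (suc n) g                  ≈⟨ +-comm _ _ ⟩
    sumTo (suc (suc n)) g                        ∎)

  sumTo-triangle : ∀ n (h : ℕ → ℕ → Carrier) →
    sumTo (suc n) (λ k → sumTo (suc k) (λ i → h i (k ∸ i))) ≈
    sumTo (suc n) (λ i → sumTo (suc (n ∸ i)) (h i))
  sumTo-triangle zero    h = refl
  sumTo-triangle (suc n) h = begin
    sumTo (suc n) (λ k → sumTo (suc k) (λ i → h i (k ∸ i))) + diagonal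
      ≈⟨ +-congʳ (sumTo-triangle n h) ⟩
    sumTo (suc n) (λ i → sumTo (suc (n ∸ i)) (h i))
      + (sumTo (suc n) (λ i → h i (suc n ∸ i)) + h (suc n) (n ∸ n))
      ≈⟨ +-assoc _ _ _ ⟨
    (sumTo (suc n) (λ i → sumTo (suc (n ∸ i)) (h i)) + sumTo (suc n) (λ i → h i (suc n ∸ i)))
      + h (suc n) (n ∸ n)
      ≈⟨ +-cong (sumTo-distrib-+ (suc n) _ _) (reflexive (≡.cong (h (suc n)) (≡.sym (ℕₚ.n∸n≡0 n)))) ⟨
    sumTo (suc n) (λ i → sumTo (suc (n ∸ i)) (h i) + h i (suc n ∸ i)) + h (suc n) 0
      ≈⟨ +-cong (sumTo-cong-< (suc n) extend) (sym (+-identityˡ _)) ⟩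
    sumTo (suc n) (λ i → sumTo (suc (suc n ∸ i)) (h i)) + (0# + h (suc n) 0)
      ≈⟨ +-congˡ (reflexive (≡.cong (λ k → sumTo (suc k) (h (suc n))) (ℕₚ.n∸n≡0 n))) ⟨
    sumTo (suc (suc n)) (λ i → sumTo (suc (suc n ∸ i)) (h i))
      ∎
    where
    diagonal = sumTo (suc (suc n)) (λ i → h i (suc n ∸ i))
    extend : ∀ i → i < suc n →
             sumTo (suc (n ∸ i)) (h i) + h i (suc n ∸ i) ≈ sumTo (suc (suc n ∸ i)) (h i)
    extend i i<1+n rewrite ℕₚ.+-∸-assoc 1 (ℕₚ.≤-pred i<1+n) = refl

  sumList-cong : ∀ {A : Set} (xs : List A) {g h : A → Carrier} → (∀ x → g x ≈ h x) →
                 sumList (map g xs) ≈ sumList (map h xs)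
  sumList-cong []       eq = refl
  sumList-cong (x ∷ xs) eq = +-cong (eq x) (sumList-cong xs eq)

  sumList-zero : ∀ {A : Set} (xs : List A) {g : A → Carrier} → (∀ x → g x ≈ 0#) →
                 sumList (map g xs) ≈ 0#
  sumList-zero []       eq = refl
  sumList-zero (x ∷ xs) eq = trans (+-cong (eq x) (sumList-zero xs eq)) (+-identityˡ 0#)

  *-distribˡ-sumList : ∀ {A : Set} (xs : List A) a (g : A → Carrier) →
                       a * sumList (map g xs) ≈ sumList (map (λ x → a * g x) xs)
  *-distribˡ-sumList []       a g = zeroʳ a
  *-distribˡ-sumList (x ∷ xs) a g = trans (distribˡ a _ _) (+-congˡ (*-distribˡ-sumList xs a g))

  sumList-++ : ∀ {A : Set} (xs ys : List A) (g : A → Carrier) →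
               sumList (map g (xs ++ ys)) ≈ sumList (map g xs) + sumList (map g ys)
  sumList-++ []       ys g = sym (+-identityˡ _)
  sumList-++ (x ∷ xs) ys g = trans (+-congˡ (sumList-++ xs ys g)) (sym (+-assoc _ _ _))

  sumList-concatMap : ∀ {A B : Set} (xs : List A) (f : A → List B) (g : B → Carrier) →
    sumList (map g (concatMap f xs)) ≈ sumList (map (λ t → sumList (map g (f t))) xs)
  sumList-concatMap []       f g = refl
  sumList-concatMap (x ∷ xs) f g =
    trans (sumList-++ (f x) (concatMap f xs) g) (+-congˡ (sumList-concatMap xs f g))

  sumList-applyUpTo : ∀ n (f : ℕ → ℕ) (g : ℕ → Carrier) →
                      sumList (map g (applyUpTo f n)) ≈ sumTo n (λ i → g (f i))
  sumList-applyUpTo zero    f g = refl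
  sumList-applyUpTo (suc n) f g =
    trans (+-congˡ (sumList-applyUpTo n (λ i → f (suc i)) g)) (sym (sumTo-head n _))

  sumList-sumTo-swap : ∀ {A : Set} (ts : List A) m (F : ℕ → A → Carrier) →
    sumList (map (λ t → sumTo m (λ x → F x t)) ts) ≈ sumTo m (λ x → sumList (map (F x) ts))
  sumList-sumTo-swap []       m F = sym (sumTo-zero m (λ _ _ → refl))
  sumList-sumTo-swap (t ∷ ts) m F =
    trans (+-congˡ (sumList-sumTo-swap ts m F)) (sym (sumTo-distrib-+ m _ _))

module SeriesSemiring {c ℓ : Level} (K : CharZeroField c ℓ) where
  open CharZeroField K hiding (zero)
  open PowerSeries K
  open Sums K
  open import Relation.Binary.Reasoning.Setoid setoid

  zeroS : Series
  zeroS _ = 0#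

  _+ₛ_ : Series → Series → Series
  (f +ₛ g) n = f n + g n

  ·-cong : ∀ {f f′ g g′} → f ≋ f′ → g ≋ g′ → (f · g) ≋ (f′ · g′)
  ·-cong f≋f′ g≋g′ n = sumTo-cong (suc n) (λ i → *-cong (f≋f′ i) (g≋g′ (n ∸ i)))

  ·-comm : ∀ f g → (f · g) ≋ (g · f)
  ·-comm f g n = begin
    sumTo (suc n) (λ i → f i * g (n ∸ i))              ≈⟨ sumTo-reverse n _ ⟩
    sumTo (suc n) (λ i → f (n ∸ i) * g (n ∸ (n ∸ i)))  ≈⟨ sumTo-cong-< (suc n) swap ⟩
    sumTo (suc n) (λ i → g i * f (n ∸ i))              ∎
    where
    swap : ∀ i → i < suc n → f (n ∸ i) * g (n ∸ (n ∸ i)) ≈ g i * f (n ∸ i)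
    swap i i<1+n rewrite ℕₚ.m∸[m∸n]≡n (ℕₚ.≤-pred i<1+n) = *-comm _ _

  ·-identityˡ : ∀ f → (oneS · f) ≋ f
  ·-identityˡ f n = trans (sumTo-single (suc n) 0 (s≤s z≤n) off) (*-identityˡ (f n))
    where
    off : ∀ i → i < suc n → i ≢ 0 → oneS i * f (n ∸ i) ≈ 0#
    off zero    _ 0≢0 = ⊥-elim (0≢0 ≡.refl)
    off (suc i) _ _   = zeroˡ _

  ·-distribʳ : ∀ h f g → ((f +ₛ g) · h) ≋ ((f · h) +ₛ (g · h))
  ·-distribʳ h f g n =
    trans (sumTo-cong (suc n) (λ i → distribʳ _ _ _)) (sumTo-distrib-+ (suc n) _ _)

  ·-zeroˡ : ∀ f → (zeroS · f) ≋ zeroS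
  ·-zeroˡ f n = sumTo-zero (suc n) (λ i _ → zeroˡ _)

  ·-assoc : ∀ f g h → ((f · g) · h) ≋ (f · (g · h))
  ·-assoc f g h n = begin
    sumTo (suc n) (λ k → sumTo (suc k) (λ i → f i * g (k ∸ i)) * h (n ∸ k))
      ≈⟨ sumTo-cong-< (suc n) (λ k _ → trans (*-distribʳ-sumTo (suc k) _ _)
           (sumTo-cong-< (suc k) (λ i i<1+k → *-congˡ (reflexive (≡.cong (λ z → h (n ∸ z))
              (≡.sym (ℕₚ.m+[n∸m]≡n (ℕₚ.≤-pred i<1+k)))))))) ⟩
    sumTo (suc n) (λ k → sumTo (suc k) (λ i → T i (k ∸ i)))
      ≈⟨ sumTo-triangle n T ⟩
    sumTo (suc n) (λ i → sumTo (suc (n ∸ i)) (T i))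
      ≈⟨ sumTo-cong (suc n) (λ i → sym (trans (*-distribˡ-sumTo (suc (n ∸ i)) _ _)
           (sumTo-cong (suc (n ∸ i)) (λ j → trans (sym (*-assoc _ _ _))
              (*-congˡ (reflexive (≡.cong h (ℕₚ.∸-+-assoc n i j)))))))) ⟩
    sumTo (suc n) (λ i → f i * sumTo (suc (n ∸ i)) (λ j → g j * h (n ∸ i ∸ j)))
      ∎
    where
    T : ℕ → ℕ → Carrier
    T i j = (f i * g j) * h (n ∸ (i ℕ.+ j))

  ≋-isEquivalence : IsEquivalence _≋_
  ≋-isEquivalence = record
    { refl  = λ n → refl
    ; sym   = λ f≋g n → sym (f≋g n)
    ; trans = λ f≋g g≋h n → trans (f≋g n) (g≋h n)
    }

  +ₛ-isCommutativeMonoid : IsCommutativeMonoid _≋_ _+ₛ_ zeroS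
  +ₛ-isCommutativeMonoid = record
    { isMonoid = record
      { isSemigroup = record
        { isMagma = record
          { isEquivalence = ≋-isEquivalence
          ; ∙-cong        = λ f≋f′ g≋g′ n → +-cong (f≋f′ n) (g≋g′ n)
          }
        ; assoc = λ f g h n → +-assoc (f n) (g n) (h n)
        }
      ; identity = (λ f n → +-identityˡ (f n)) , (λ f n → +-identityʳ (f n))
      }
    ; comm = λ f g n → +-comm (f n) (g n)
    }

  ·-isCommutativeMonoid : IsCommutativeMonoid _≋_ _·_ oneS
  ·-isCommutativeMonoid = record
    { isMonoid = record
      { isSemigroup = record
        { isMagma = record { isEquivalence = ≋-isEquivalence ; ∙-cong = ·-cong }
        ; assoc   = ·-assoc
        }
      ; identity = ·-identityˡ , (λ f n → trans (·-comm f oneS n) (·-identityˡ f n))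
      }
    ; comm = ·-comm
    }

  seriesSemiring : CommutativeSemiring c ℓ
  seriesSemiring = record
    { Carrier = Series
    ; _≈_     = _≋_
    ; _+_     = _+ₛ_
    ; _*_     = _·_
    ; 0#      = zeroS
    ; 1#      = oneS
    ; isCommutativeSemiring = isCommutativeSemiringˡ record
      { +-isCommutativeMonoid = +ₛ-isCommutativeMonoid
      ; *-isCommutativeMonoid = ·-isCommutativeMonoid
      ; distribʳ              = ·-distribʳ
      ; zeroˡ                 = ·-zeroˡ
      }
    }

module SeriesPowers {c ℓ : Level} (K : CharZeroField c ℓ) where
  open CharZeroField K hiding (zero)
  open PowerSeries K
  open Sums K
  open SeriesSemiring K
  open import Relation.Binary.Reasoning.Setoid setoid
  open import Algebra.Properties.Semiring.Exp (CommutativeSemiring.semiring seriesSemiring)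
    using (_^_; ^-homo-*)

  powS≋^ : ∀ f k → powS f k ≋ (f ^ k)
  powS≋^ f zero    n = refl
  powS≋^ f (suc k)   = ·-cong {f} {f} (λ _ → refl) (powS≋^ f k)

  powS-+ : ∀ f i j → powS f (i ℕ.+ j) ≋ (powS f i · powS f j)
  powS-+ f i j n = begin
    powS f (i ℕ.+ j) n        ≈⟨ powS≋^ f (i ℕ.+ j) n ⟩
    (f ^ (i ℕ.+ j)) n         ≈⟨ ^-homo-* f i j n ⟩
    ((f ^ i) · (f ^ j)) n     ≈⟨ ·-cong (powS≋^ f i) (powS≋^ f j) n ⟨
    (powS f i · powS f j) n   ∎

  powS-1 : ∀ f → powS f 1 ≋ f
  powS-1 f n = trans (·-comm f oneS n) (·-identityˡ f n)

  powS-vanish : ∀ {f} → f 0 ≈ 0# → ∀ k m → m < k → powS f k m ≈ 0#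
  powS-vanish {f} f0≈0 (suc k) m m<1+k = sumTo-zero (suc m) term
    where
    term : ∀ i → i < suc m → f i * powS f k (m ∸ i) ≈ 0#
    term zero    _ = trans (*-congʳ f0≈0) (zeroˡ _)
    term (suc i) i<1+m = trans (*-congˡ (powS-vanish f0≈0 k (m ∸ suc i)
      (ℕₚ.<-≤-trans (ℕₚ.∸-monoʳ-< (s≤s z≤n) (ℕₚ.≤-pred i<1+m)) (ℕₚ.≤-pred m<1+k)))) (zeroʳ _)

  powS-diagonal : ∀ {f} → f 0 ≈ 0# → ∀ k → powS f k k ≈ powK (f 1) k
  powS-diagonal         f0≈0 zero    = refl
  powS-diagonal {f} f0≈0 (suc k) =
    trans (sumTo-single (suc (suc k)) 1 (s≤s (s≤s z≤n)) off) (*-congˡ (powS-diagonal f0≈0 k))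
    where
    off : ∀ i → i < suc (suc k) → i ≢ 1 → f i * powS f k (suc k ∸ i) ≈ 0#
    off zero          _               _   = trans (*-congʳ f0≈0) (zeroˡ _)
    off (suc zero)    _               1≢1 = ⊥-elim (1≢1 ≡.refl)
    off (suc (suc i)) (s≤s (s≤s i<k)) _   =
      trans (*-congˡ (powS-vanish f0≈0 k (k ∸ suc i) (ℕₚ.∸-monoʳ-< (s≤s z≤n) i<k))) (zeroʳ _)

  idS·-suc : ∀ P n → (idS · P) (suc n) ≈ P n
  idS·-suc P n = trans (sumTo-single (suc (suc n)) 1 (s≤s (s≤s z≤n)) off) (*-identityˡ _)
    where
    off : ∀ i → i < suc (suc n) → i ≢ 1 → idS i * P (suc n ∸ i) ≈ 0#
    off zero          _ _   = zeroˡ _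
    off (suc zero)    _ 1≢1 = ⊥-elim (1≢1 ≡.refl)
    off (suc (suc i)) _ _   = zeroˡ _

  powS-idS-off-diagonal : ∀ k n → n ≢ k → powS idS k n ≈ 0#
  powS-idS-off-diagonal zero    zero    0≢0 = ⊥-elim (0≢0 ≡.refl)
  powS-idS-off-diagonal zero    (suc n) _   = refl
  powS-idS-off-diagonal (suc k) zero    _   = trans (+-identityˡ _) (zeroˡ _)
  powS-idS-off-diagonal (suc k) (suc n) n≢k =
    trans (idS·-suc (powS idS k) n) (powS-idS-off-diagonal k n (λ n≡k → n≢k (≡.cong suc n≡k)))

  powS-cong-≤ : ∀ {a b} M → a 0 ≈ 0# → b 0 ≈ 0# → (∀ i → i ≤ M → a i ≈ b i) →
                ∀ k n → n < M ℕ.+ k → powS a k n ≈ powS b k n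
  powS-cong-≤         M a0 b0 a≈b zero    n _  = refl
  powS-cong-≤ {a} {b} M a0 b0 a≈b (suc k) n lt = sumTo-cong-< (suc n) term
    where
    term : ∀ i → i < suc n → a i * powS a k (n ∸ i) ≈ b i * powS b k (n ∸ i)
    term zero _ = trans (*-congʳ a0) (trans (zeroˡ _) (sym (trans (*-congʳ b0) (zeroˡ _))))
    term (suc i) i<1+n with suc i ℕ.≤? M
    ... | yes 1+i≤M = *-cong (a≈b (suc i) 1+i≤M)
            (powS-cong-≤ M a0 b0 a≈b k (n ∸ suc i) (n≤m⇒m<n+o⇒m∸n<o n (suc i) (M ℕ.+ k) (ℕₚ.≤-pred i<1+n)
              (ℕₚ.<-≤-trans lt (ℕₚ.≤-trans (ℕₚ.≤-reflexive (ℕₚ.+-suc M k))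
                                           (s≤s (ℕₚ.m≤n+m (M ℕ.+ k) i))))))
    ... | no 1+i≰M = trans (*-congˡ (powS-vanish a0 k (n ∸ suc i) short))
                      (trans (zeroʳ _) (sym (trans (*-congˡ (powS-vanish b0 k (n ∸ suc i) short))
                                                   (zeroʳ _))))
      where
      short : n ∸ suc i < k
      short = n≤m⇒m<n+o⇒m∸n<o n (suc i) k (ℕₚ.≤-pred i<1+n)
        (ℕₚ.<-≤-trans lt (ℕₚ.≤-trans (ℕₚ.≤-reflexive (ℕₚ.+-suc M k))
                                     (ℕₚ.+-monoˡ-≤ k (ℕₚ.≰⇒> 1+i≰M))))

module Composition {c ℓ : Level} (K : CharZeroField c ℓ) where
  open CharZeroField K hiding (zero)
  open PowerSeries K
  open Sums K
  open SeriesSemiring K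
  open SeriesPowers K
  open import Relation.Binary.Reasoning.Setoid setoid
  open CommutativeSemigroupProperties *-commutativeSemigroup using ()
    renaming (interchange to *-interchange)

  oneS-∘ₛ : ∀ f n → (oneS ∘ₛ f) n ≈ oneS n
  oneS-∘ₛ f n = trans (sumTo-single (suc n) 0 (s≤s z≤n) off) (*-identityˡ _)
    where
    off : ∀ k → k < suc n → k ≢ 0 → oneS k * powS f k n ≈ 0#
    off zero    _ 0≢0 = ⊥-elim (0≢0 ≡.refl)
    off (suc k) _ _   = zeroˡ _

  ∘ₛ-extend : ∀ {f} → f 0 ≈ 0# → ∀ (g : ℕ → Carrier) p n → p ≤ n →
    (g ∘ₛ f) p ≈ sumTo (suc n) (λ i → g i * powS f i p)
  ∘ₛ-extend f0≈0 g p n p≤n = sym (sumTo-truncate (suc p) (suc n) (s≤s p≤n)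
    (λ i p<i _ → trans (*-congˡ (powS-vanish f0≈0 i p p<i)) (zeroʳ _)))

  -- Both sides expand to Σ_{i,j,p} aᵢ bⱼ [xᵖ]fⁱ [xⁿ⁻ᵖ]fʲ.
  ·-∘ₛ : ∀ {f} → f 0 ≈ 0# → ∀ a b → ((a · b) ∘ₛ f) ≋ ((a ∘ₛ f) · (b ∘ₛ f))
  ·-∘ₛ {f} f0≈0 a b n = begin
    sumTo (suc n) (λ k → sumTo (suc k) (λ i → a i * b (k ∸ i)) * F k n)
      ≈⟨ sumTo-cong (suc n) (λ k → trans (*-distribʳ-sumTo (suc k) _ _)
           (sumTo-cong-< (suc k) (λ i i<1+k → *-congˡ (reflexive (≡.cong (λ z → F z n)
              (≡.sym (ℕₚ.m+[n∸m]≡n (ℕₚ.≤-pred i<1+k)))))))) ⟩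
    sumTo (suc n) (λ k → sumTo (suc k) (λ i → T i (k ∸ i)))
      ≈⟨ sumTo-triangle n T ⟩
    sumTo (suc n) (λ i → sumTo (suc (n ∸ i)) (T i))
      ≈⟨ sumTo-cong-< (suc n) (λ i i<1+n → sym (sumTo-truncate (suc (n ∸ i)) (suc n)
           (s≤s (ℕₚ.m∸n≤m n i)) (λ j n∸i<j _ → trans (*-congˡ (powS-vanish f0≈0 (i ℕ.+ j) n
              (beyond (ℕₚ.≤-pred i<1+n) n∸i<j))) (zeroʳ _)))) ⟩
    sumTo (suc n) (λ i → sumTo (suc n) (T i))
      ≈⟨ sumTo-cong (suc n) (λ i → sumTo-cong (suc n) (λ j → *-congˡ (powS-+ f i j n))) ⟩
    sumTo (suc n) (λ i → sumTo (suc n) (λ j →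
      (a i * b j) * sumTo (suc n) (λ p → F i p * F j (n ∸ p))))
      ≈⟨ sumTo-cong (suc n) (λ i → sumTo-cong (suc n) (λ j → trans (*-distribˡ-sumTo (suc n) _ _)
           (sumTo-cong (suc n) (λ p → *-interchange _ _ _ _)))) ⟩
    sumTo (suc n) (λ i → sumTo (suc n) (λ j → sumTo (suc n) (λ p → A i p * B j p)))
      ≈⟨ sumTo-cong (suc n) (λ i → sumTo-swap (suc n) (suc n) _) ⟩
    sumTo (suc n) (λ i → sumTo (suc n) (λ p → sumTo (suc n) (λ j → A i p * B j p)))
      ≈⟨ sumTo-swap (suc n) (suc n) _ ⟩
    sumTo (suc n) (λ p → sumTo (suc n) (λ i → sumTo (suc n) (λ j → A i p * B j p)))
      ≈⟨ sumTo-cong (suc n) (λ p → sumTo-*-sumTo (suc n) (suc n) _ _) ⟨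
    sumTo (suc n) (λ p → sumTo (suc n) (λ i → A i p) * sumTo (suc n) (λ j → B j p))
      ≈⟨ sumTo-cong-< (suc n) (λ p p<1+n → *-cong (∘ₛ-extend f0≈0 a p n (ℕₚ.≤-pred p<1+n))
                                                  (∘ₛ-extend f0≈0 b (n ∸ p) n (ℕₚ.m∸n≤m n p))) ⟨
    sumTo (suc n) (λ p → (a ∘ₛ f) p * (b ∘ₛ f) (n ∸ p))
      ∎
    where
    F : ℕ → ℕ → Carrier
    F k m = powS f k m
    T : ℕ → ℕ → Carrier
    T i j = (a i * b j) * F (i ℕ.+ j) n
    A B : ℕ → ℕ → Carrier
    A i p = a i * F i p
    B j p = b j * F j (n ∸ p)
    beyond : ∀ {i j} → i ≤ n → n ∸ i < j → n < i ℕ.+ j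
    beyond {i} i≤n n∸i<j =
      ℕₚ.≤-trans (ℕₚ.≤-reflexive (≡.cong suc (≡.sym (ℕₚ.m+[n∸m]≡n i≤n))))
                 (ℕₚ.≤-trans (ℕₚ.≤-reflexive (≡.sym (ℕₚ.+-suc i _))) (ℕₚ.+-monoʳ-≤ i n∸i<j))

  powS-∘ₛ : ∀ {f} → f 0 ≈ 0# → ∀ a l → powS (a ∘ₛ f) l ≋ (powS a l ∘ₛ f)
  powS-∘ₛ {f} f0≈0 a zero    n = sym (oneS-∘ₛ f n)
  powS-∘ₛ {f} f0≈0 a (suc l) n =
    trans (·-cong {a ∘ₛ f} {a ∘ₛ f} (λ _ → refl) (powS-∘ₛ f0≈0 a l) n)
          (sym (·-∘ₛ f0≈0 a (powS a l) n))

  ∘ₛ-assoc : ∀ a {b f} → b 0 ≈ 0# → f 0 ≈ 0# → (a ∘ₛ (b ∘ₛ f)) ≋ ((a ∘ₛ b) ∘ₛ f)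
  ∘ₛ-assoc a {b} {f} b0≈0 f0≈0 n = begin
    sumTo (suc n) (λ l → a l * powS (b ∘ₛ f) l n)
      ≈⟨ sumTo-cong (suc n) (λ l → trans (*-congˡ (powS-∘ₛ f0≈0 b l n)) (*-distribˡ-sumTo (suc n) _ _)) ⟩
    sumTo (suc n) (λ l → sumTo (suc n) (λ k → a l * (powS b l k * powS f k n)))
      ≈⟨ sumTo-swap (suc n) (suc n) _ ⟩
    sumTo (suc n) (λ k → sumTo (suc n) (λ l → a l * (powS b l k * powS f k n)))
      ≈⟨ sumTo-cong-< (suc n) (λ k k<1+n → trans (sumTo-cong (suc n) (λ l → sym (*-assoc _ _ _)))
           (trans (sym (*-distribʳ-sumTo (suc n) _ _))
             (*-congʳ (sym (∘ₛ-extend {b} b0≈0 a k n (ℕₚ.≤-pred k<1+n)))))) ⟩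
    sumTo (suc n) (λ k → (a ∘ₛ b) k * powS f k n)
      ∎

  ∘ₛ-split : ∀ g {f} → f 0 ≈ 0# → ∀ r →
    (g ∘ₛ f) (2 ℕ.+ r) ≈
      (g 1 * f (2 ℕ.+ r) + sumTo r (λ i → g (2 ℕ.+ i) * powS f (2 ℕ.+ i) (2 ℕ.+ r)))
      + g (2 ℕ.+ r) * powK (f 1) (2 ℕ.+ r)
  ∘ₛ-split g {f} f0≈0 r = begin
    sumTo (3 ℕ.+ r) G
      ≈⟨ +-congʳ (sumTo-head (suc r) G) ⟩
    (G 0 + sumTo (suc r) (λ i → G (suc i))) + G (2 ℕ.+ r)
      ≈⟨ +-congʳ (+-cong (zeroʳ (g 0)) (sumTo-head r (λ i → G (suc i)))) ⟩
    (0# + (G 1 + sumTo r (λ i → G (2 ℕ.+ i)))) + G (2 ℕ.+ r)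
      ≈⟨ +-cong (trans (+-identityˡ _) (+-congʳ (*-congˡ (powS-1 f _))))
                (*-congˡ (powS-diagonal f0≈0 (2 ℕ.+ r))) ⟩
    (g 1 * f (2 ℕ.+ r) + sumTo r (λ i → G (2 ℕ.+ i))) + g (2 ℕ.+ r) * powK (f 1) (2 ℕ.+ r)
      ∎
    where
    G : ℕ → Carrier
    G k = g k * powS f k (2 ℕ.+ r)

module BellPolynomial {c ℓ : Level} (K : CharZeroField c ℓ) where
  open CharZeroField K hiding (zero)
  open PowerSeries K
  open CharZeroFieldProperties K
  open Sums K
  open SeriesSemiring K
  open SeriesPowers K
  open import Relation.Binary.Reasoning.Setoid setoid
  open import Algebra.Properties.Semiring.Exp (CommutativeSemiring.semiring seriesSemiring)
    using () renaming (_^_ to _^ₛ_)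
  open import Algebra.Properties.Semiring.Mult (CommutativeSemiring.semiring seriesSemiring)
    using () renaming (_×_ to _×ₛ_)
  open import Algebra.Properties.Semiring.Sum (CommutativeSemiring.semiring seriesSemiring)
    using () renaming (sum to sumₛ)
  import Algebra.Properties.CommutativeSemiring.Binomial seriesSemiring as Binomial

  monomial : ℕ → Carrier → Series
  monomial zero    a zero    = a
  monomial zero    a (suc i) = 0#
  monomial (suc d) a zero    = 0#
  monomial (suc d) a (suc i) = monomial d a i

  monomial-diagonal : ∀ d a → monomial d a d ≡ a
  monomial-diagonal zero    a = ≡.refl
  monomial-diagonal (suc d) a = monomial-diagonal d a

  monomial-off-diagonal : ∀ d a i → i ≢ d → monomial d a i ≈ 0#
  monomial-off-diagonal zero    a zero    0≢0 = ⊥-elim (0≢0 ≡.refl)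
  monomial-off-diagonal zero    a (suc i) _   = refl
  monomial-off-diagonal (suc d) a zero    _   = refl
  monomial-off-diagonal (suc d) a (suc i) i≢d =
    monomial-off-diagonal d a i (λ i≡d → i≢d (≡.cong suc i≡d))

  *-monomial : ∀ d a b n → a * monomial d b n ≈ monomial d (a * b) n
  *-monomial zero    a b zero    = refl
  *-monomial zero    a b (suc n) = zeroʳ a
  *-monomial (suc d) a b zero    = zeroʳ a
  *-monomial (suc d) a b (suc n) = *-monomial d a b n

  shift : ℕ → Series → Series
  shift zero    B         = B
  shift (suc d) B zero    = 0#
  shift (suc d) B (suc n) = shift d B n

  shift-cong : ∀ d {A B} → A ≋ B → shift d A ≋ shift d B
  shift-cong zero    A≋B w       = A≋B w
  shift-cong (suc d) A≋B zero    = refl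
  shift-cong (suc d) A≋B (suc w) = shift-cong d A≋B w

  *-shift : ∀ d a B w → a * shift d B w ≈ shift d (λ w′ → a * B w′) w
  *-shift zero    a B w       = refl
  *-shift (suc d) a B zero    = zeroʳ a
  *-shift (suc d) a B (suc w) = *-shift d a B w

  sumList-shift : ∀ {A : Set} (ts : List A) d (φ : A → Series) w →
    sumList (map (λ t → shift d (φ t) w) ts) ≈ shift d (λ w′ → sumList (map (λ t → φ t w′) ts)) w
  sumList-shift ts zero    φ w       = refl
  sumList-shift ts (suc d) φ zero    = sumList-zero ts (λ _ → refl)
  sumList-shift ts (suc d) φ (suc w) = sumList-shift ts d φ w

  shift-monomial : ∀ d e a n → shift d (monomial e a) n ≈ monomial (d ℕ.+ e) a n
  shift-monomial zero    e a n       = refl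
  shift-monomial (suc d) e a zero    = refl
  shift-monomial (suc d) e a (suc n) = shift-monomial d e a n

  monomial-· : ∀ d a B n → (monomial d a · B) n ≈ a * shift d B n
  monomial-· zero a B n = sumTo-single (suc n) 0 (s≤s z≤n)
    (λ i _ i≢0 → trans (*-congʳ (monomial-off-diagonal 0 a i i≢0)) (zeroˡ _))
  monomial-· (suc d) a B zero    = trans (+-identityˡ _) (trans (zeroˡ _) (sym (zeroʳ a)))
  monomial-· (suc d) a B (suc n) =
    trans (sumTo-head (suc n) _) (trans (x≈0⇒x+y≈y (zeroˡ _)) (monomial-· d a B n))
    where
    x≈0⇒x+y≈y : ∀ {x y} → x ≈ 0# → x + y ≈ y
    x≈0⇒x+y≈y x≈0 = trans (+-congʳ x≈0) (+-identityˡ _)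

  powS-monomial : ∀ d a x n → powS (monomial d a) x n ≈ monomial (x ℕ.* d) (powK a x) n
  powS-monomial d a zero    zero    = refl
  powS-monomial d a zero    (suc n) = refl
  powS-monomial d a (suc x) n = begin
    (monomial d a · powS (monomial d a) x) n          ≈⟨ ·-cong {monomial d a} (λ _ → refl) (powS-monomial d a x) n ⟩
    (monomial d a · monomial (x ℕ.* d) (powK a x)) n  ≈⟨ monomial-· d a _ n ⟩
    a * shift d (monomial (x ℕ.* d) (powK a x)) n     ≈⟨ *-congˡ (shift-monomial d _ _ n) ⟩
    a * monomial (d ℕ.+ x ℕ.* d) (powK a x) n         ≈⟨ *-monomial (d ℕ.+ x ℕ.* d) a (powK a x) n ⟩
    monomial (suc x ℕ.* d) (powK a (suc x)) n         ∎

  powS-+ₛ : ∀ A B s w →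
    powS (A +ₛ B) s w ≈ sumTo (suc s) (λ x → fromℕ (s C x) * (powS A x · powS B (s ∸ x)) w)
  powS-+ₛ A B s w = begin
    powS (A +ₛ B) s w               ≈⟨ powS≋^ (A +ₛ B) s w ⟩
    ((A +ₛ B) ^ₛ s) w               ≈⟨ Binomial.theorem s A B w ⟩
    Binomial.binomialExpansion A B s w
      ≈⟨ sumₛ-coefficient (suc s) (λ x → (s C x) ×ₛ ((A ^ₛ x) · (B ^ₛ (s ∸ x)))) w ⟩
    sumTo (suc s) (λ x → ((s C x) ×ₛ ((A ^ₛ x) · (B ^ₛ (s ∸ x)))) w)
      ≈⟨ sumTo-cong (suc s) (λ x → trans (×ₛ-coefficient (s C x) _ w)
           (*-congˡ (sym (·-cong (powS≋^ A x) (powS≋^ B (s ∸ x)) w)))) ⟩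
    sumTo (suc s) (λ x → fromℕ (s C x) * (powS A x · powS B (s ∸ x)) w) ∎
    where
    sumₛ-coefficient : ∀ m (v : ℕ → Series) w → sumₛ {m} (λ k → v (toℕ k)) w ≈ sumTo m (λ i → v i w)
    sumₛ-coefficient zero    v w = refl
    sumₛ-coefficient (suc m) v w =
      trans (+-congˡ (sumₛ-coefficient m (λ i → v (suc i)) w)) (sym (sumTo-head m _))
    ×ₛ-coefficient : ∀ m Z w → (m ×ₛ Z) w ≈ fromℕ m * Z w
    ×ₛ-coefficient zero    Z w = sym (zeroˡ _)
    ×ₛ-coefficient (suc m) Z w =
      trans (+-cong (sym (*-identityˡ _)) (×ₛ-coefficient m Z w)) (sym (distribʳ _ _ _))

  if-*ʳ : ∀ (P : Bool) a v → (if P then a * v else 0#) ≈ a * (if P then v else 0#)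
  if-*ʳ true  a v = refl
  if-*ʳ false a v = sym (zeroʳ a)

  if-≡ᵇ-+ : ∀ (P : Bool) d t w v →
    (if P ∧ (d ℕ.+ t ≡ᵇ w) then v else 0#) ≈ shift d (λ w′ → if P ∧ (t ≡ᵇ w′) then v else 0#) w
  if-≡ᵇ-+ P     zero    t w       v = refl
  if-≡ᵇ-+ true  (suc d) t zero    v = refl
  if-≡ᵇ-+ false (suc d) t zero    v = refl
  if-≡ᵇ-+ P     (suc d) t (suc w) v = if-≡ᵇ-+ P d t w v

  module _ (X : ℕ → Carrier) where

    scaled : ℕ → Carrier
    scaled i = X i * fromℕ (i !) ⁻¹

    termHead : ℕ → ℕ → Carrier
    termHead j x = fromℕ (x !) ⁻¹ * powK (scaled j) x

    restricted : ℕ → ℕ → ℕ → List ℕ → Carrier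
    restricted j s w t =
      if (ListAction.sum t ≡ᵇ s) ∧ (weightFrom j t ≡ᵇ w) then termFrom X j t else 0#

    tupleSum : ℕ → ℕ → ℕ → ℕ → ℕ → Carrier
    tupleSum j L b s w = sumList (map (restricted j s w) (allTuples L b))

    -- Σ_{j ≤ i < j + L} Xᵢ xⁱ / i!, a segment of the exponential generating function of X.
    egfSegment : ℕ → ℕ → Series
    egfSegment j zero    = zeroS
    egfSegment j (suc L) = monomial j (scaled j) +ₛ egfSegment (suc j) L

    tupleSum-suc : ∀ j L b s w → s ≤ b →
      tupleSum j (suc L) b s w ≈
      sumTo (suc s) (λ x → termHead j x * shift (j ℕ.* x) (tupleSum (suc j) L b (s ∸ x)) w)
    tupleSum-suc j L b s w s≤b = begin
      tupleSum j (suc L) b s w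
        ≈⟨ sumList-concatMap ts _ φ ⟩
      sumList (map (λ t → sumList (map φ (map (_∷ t) (upTo (suc b))))) ts)
        ≈⟨ sumList-cong ts (λ t → trans (reflexive (≡.cong sumList (≡.sym (map-∘ (upTo (suc b))))))
                                        (sumList-applyUpTo (suc b) (λ x → x) _)) ⟩
      sumList (map (λ t → sumTo (suc b) (λ x → φ (x ∷ t))) ts)
        ≈⟨ sumList-sumTo-swap ts (suc b) (λ x t → φ (x ∷ t)) ⟩
      sumTo (suc b) (λ x → sumList (map (λ t → φ (x ∷ t)) ts))
        ≈⟨ sumTo-truncate (suc s) (suc b) (s≤s s≤b)
             (λ x s<x _ → sumList-zero ts (λ t → too-large x t s<x)) ⟩
      sumTo (suc s) (λ x → sumList (map (λ t → φ (x ∷ t)) ts))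
        ≈⟨ sumTo-cong-< (suc s) (λ x x<1+s → split-head x (ℕₚ.≤-pred x<1+s)) ⟩
      sumTo (suc s) (λ x → termHead j x * shift (j ℕ.* x) (tupleSum (suc j) L b (s ∸ x)) w)
        ∎
      where
      ts = allTuples L b
      φ = restricted j s w
      ψ : ℕ → List ℕ → Series
      ψ x t w′ = restricted (suc j) (s ∸ x) w′ t

      too-large : ∀ x t → s < x →
        (if (x ℕ.+ ListAction.sum t ≡ᵇ s) ∧ (j ℕ.* x ℕ.+ weightFrom (suc j) t ≡ᵇ w)
         then termHead j x * termFrom X (suc j) t else 0#) ≈ 0#
      too-large x t s<x rewrite +-≡ᵇ-> x (ListAction.sum t) s s<x = refl

      split-term : ∀ x t → x ≤ s →
        (if (x ℕ.+ ListAction.sum t ≡ᵇ s) ∧ (j ℕ.* x ℕ.+ weightFrom (suc j) t ≡ᵇ w)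
         then termHead j x * termFrom X (suc j) t else 0#) ≈
        termHead j x * shift (j ℕ.* x) (ψ x t) w
      split-term x t x≤s rewrite +-≡ᵇ-≤ x (ListAction.sum t) s x≤s =
        trans (if-*ʳ ((ListAction.sum t ≡ᵇ s ∸ x) ∧ (j ℕ.* x ℕ.+ weightFrom (suc j) t ≡ᵇ w)) _ _)
              (*-congˡ (if-≡ᵇ-+ (ListAction.sum t ≡ᵇ s ∸ x) (j ℕ.* x) _ w _))

      split-head : ∀ x → x ≤ s → sumList (map (λ t → φ (x ∷ t)) ts) ≈
                   termHead j x * shift (j ℕ.* x) (tupleSum (suc j) L b (s ∸ x)) w
      split-head x x≤s = begin
        sumList (map (λ t → φ (x ∷ t)) ts)
          ≈⟨ sumList-cong ts (λ t → split-term x t x≤s) ⟩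
        sumList (map (λ t → termHead j x * shift (j ℕ.* x) (ψ x t) w) ts)
          ≈⟨ *-distribˡ-sumList ts (termHead j x) _ ⟨
        termHead j x * sumList (map (λ t → shift (j ℕ.* x) (ψ x t) w) ts)
          ≈⟨ *-congˡ (sumList-shift ts (j ℕ.* x) (ψ x) w) ⟩
        termHead j x * shift (j ℕ.* x) (tupleSum (suc j) L b (s ∸ x)) w
          ∎

    -- Induction on L: split off the first monomial of the segment by the binomial theorem.
    tupleSum≈powS : ∀ L j b s w → s ≤ b →
      fromℕ (s !) * tupleSum j L b s w ≈ powS (egfSegment j L) s w
    tupleSum≈powS zero j b zero    zero    _ =
      trans (*-cong (+-identityʳ 1#) (+-identityʳ 1#)) (*-identityˡ 1#)
    tupleSum≈powS zero j b zero    (suc w) _ = trans (*-congˡ (+-identityʳ 0#)) (zeroʳ _)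
    tupleSum≈powS zero j b (suc s) w       _ =
      trans (*-congˡ (+-identityʳ 0#)) (trans (zeroʳ _) (sym (·-zeroˡ (powS zeroS s) w)))
    tupleSum≈powS (suc L) j b s w s≤b = begin
      fromℕ (s !) * tupleSum j (suc L) b s w
        ≈⟨ *-congˡ (tupleSum-suc j L b s w s≤b) ⟩
      fromℕ (s !) * sumTo (suc s) (λ x → termHead j x * rest x)
        ≈⟨ *-distribˡ-sumTo (suc s) _ _ ⟩
      sumTo (suc s) (λ x → fromℕ (s !) * (termHead j x * rest x))
        ≈⟨ sumTo-cong-< (suc s) (λ x x<1+s → term x (ℕₚ.≤-pred x<1+s)) ⟨
      sumTo (suc s) (λ x → fromℕ (s C x) * (powS A x · powS B (s ∸ x)) w)
        ≈⟨ powS-+ₛ A B s w ⟨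
      powS (egfSegment j (suc L)) s w
        ∎
      where
      A = monomial j (scaled j)
      B = egfSegment (suc j) L
      rest : ℕ → Carrier
      rest x = shift (j ℕ.* x) (tupleSum (suc j) L b (s ∸ x)) w
      term : ∀ x → x ≤ s →
        fromℕ (s C x) * (powS A x · powS B (s ∸ x)) w ≈ fromℕ (s !) * (termHead j x * rest x)
      term x x≤s = begin
        fromℕ (s C x) * (powS A x · powS B (s ∸ x)) w
          ≈⟨ *-congˡ (·-cong {g = powS B (s ∸ x)} (powS-monomial j (scaled j) x) (λ _ → refl) w) ⟩
        fromℕ (s C x) * (monomial (x ℕ.* j) p · powS B (s ∸ x)) w
          ≈⟨ *-congˡ (monomial-· (x ℕ.* j) p (powS B (s ∸ x)) w) ⟩
        fromℕ (s C x) * (p * shift (x ℕ.* j) (powS B (s ∸ x)) w)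
          ≈⟨ *-congˡ (*-congˡ (shift-cong (x ℕ.* j) (λ w′ → tupleSum≈powS L (suc j) b (s ∸ x) w′
               (ℕₚ.≤-trans (ℕₚ.m∸n≤m s x) s≤b)) w)) ⟨
        fromℕ (s C x) * (p * shift (x ℕ.* j) (λ w′ → F * tupleSum (suc j) L b (s ∸ x) w′) w)
          ≈⟨ *-congˡ (*-congˡ (*-shift (x ℕ.* j) F _ w)) ⟨
        fromℕ (s C x) * (p * (F * shift (x ℕ.* j) (tupleSum (suc j) L b (s ∸ x)) w))
          ≈⟨ *-congˡ (*-congˡ (*-congˡ (reflexive
               (≡.cong (λ d → shift d (tupleSum (suc j) L b (s ∸ x)) w) (ℕₚ.*-comm x j))))) ⟩
        fromℕ (s C x) * (p * (F * rest x))
          ≈⟨ binomial-rescale s x x≤s p (rest x) ⟩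
        fromℕ (s !) * (termHead j x * rest x)
          ∎
        where
        p = powK (scaled j) x
        F = fromℕ ((s ∸ x) !)

    egfSegment-below : ∀ L j i → i < j → egfSegment j L i ≈ 0#
    egfSegment-below zero    j i _   = refl
    egfSegment-below (suc L) j i i<j =
      trans (+-cong (monomial-off-diagonal j (scaled j) i (ℕₚ.<⇒≢ i<j))
                    (egfSegment-below L (suc j) i (ℕₚ.m<n⇒m<1+n i<j)))
            (+-identityˡ 0#)

    egfSegment-within : ∀ L j i → j ≤ i → i < j ℕ.+ L → egfSegment j L i ≈ scaled i
    egfSegment-within zero    j i j≤i i<j+0 =
      ⊥-elim (ℕₚ.<-irrefl ≡.refl (ℕₚ.<-≤-trans (ℕₚ.≤-<-trans j≤i i<j+0) (ℕₚ.≤-reflexive (ℕₚ.+-identityʳ j))))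
    egfSegment-within (suc L) j i j≤i i<j+1+L with ℕₚ.m≤n⇒m<n∨m≡n j≤i
    ... | inj₂ ≡.refl =
      trans (+-cong (reflexive (monomial-diagonal j (scaled j)))
                    (egfSegment-below L (suc j) j (ℕₚ.n<1+n j)))
            (+-identityʳ _)
    ... | inj₁ j<i =
      trans (+-cong (monomial-off-diagonal j (scaled j) i (≡.≢-sym (ℕₚ.<⇒≢ j<i)))
                    (egfSegment-within L (suc j) i j<i
                      (ℕₚ.<-≤-trans i<j+1+L (ℕₚ.≤-reflexive (ℕₚ.+-suc j L)))))
            (+-identityˡ _)

    Bell≈powS-egfSegment : ∀ n k → k ≤ n →
      Bell n k X ≈ fromℕ (n !) * (fromℕ (k !) ⁻¹ * powS (egfSegment 1 (suc (n ∸ k))) k n)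
    Bell≈powS-egfSegment n k k≤n = begin
      Bell n k X
        ≈⟨ sumList-cong tuples (λ ks → if-*ʳ ((ListAction.sum ks ≡ᵇ k) ∧ (weightFrom 1 ks ≡ᵇ n))
                                              (fromℕ (n !)) (termFrom X 1 ks)) ⟩
      sumList (map (λ ks → fromℕ (n !) * restricted 1 k n ks) tuples)
        ≈⟨ *-distribˡ-sumList tuples (fromℕ (n !)) _ ⟨
      fromℕ (n !) * S
        ≈⟨ *-congˡ (trans (sym (*-identityˡ _)) (trans (*-congʳ (sym (trans (*-comm _ _) (n!*n!⁻¹≈1 k))))
                                                       (*-assoc _ _ _))) ⟩
      fromℕ (n !) * (fromℕ (k !) ⁻¹ * (fromℕ (k !) * S))
        ≈⟨ *-congˡ (*-congˡ (tupleSum≈powS (suc (n ∸ k)) 1 n k n k≤n)) ⟩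
      fromℕ (n !) * (fromℕ (k !) ⁻¹ * powS (egfSegment 1 (suc (n ∸ k))) k n)
        ∎
      where
      tuples = allTuples (suc (n ∸ k)) n
      S = tupleSum 1 (suc (n ∸ k)) n k n

module Involution {c ℓ : Level} (K : CharZeroField c ℓ) where
  open CharZeroField K hiding (zero)
  open PowerSeries K
  open Sums K
  open SeriesPowers K
  open Composition K
  open BellPolynomial K
  open CharZeroFieldProperties K
  open import Relation.Binary.Reasoning.Setoid setoid
  open RingProperties ring using (-1*x≈-x)
  open GroupProperties +-group using (∙-cancelʳ)
  open import Algebra.Properties.AbelianGroup +-abelianGroup using (⁻¹-∙-comm)
  open CommutativeSemigroupProperties *-commutativeSemigroup using (x∙yz≈y∙xz)
    renaming (interchange to *-interchange)

  OddFormula : Series → ℕ → ℕ → Set ℓ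
  OddFormula f n N = taylor n f ≈ half * sumFromTo 2 N (λ k → taylor k f * Bell n k (argSeq f))

  CoefficientFormula : Series → Set (c ⊔ ℓ)
  CoefficientFormula f = Σ (ℕ → Carrier) λ a →
    (taylor 1 f ≈ - 1#)
    × (∀ m → 1 ≤ m → taylor (2 ℕ.* m) f ≈ a m)
    × (∀ m → 1 ≤ m → OddFormula f (2 ℕ.* m ℕ.+ 1) (2 ℕ.* m))

  taylor-1 : ∀ f → taylor 1 f ≈ f 1
  taylor-1 f = trans (*-congʳ (+-identityʳ 1#)) (*-identityˡ _)

  module _ (f : Series) (f0≈0 : f 0 ≈ 0#) where

    ∘ₛ-self-0 : (f ∘ₛ f) 0 ≈ 0#
    ∘ₛ-self-0 = trans (+-identityˡ _) (trans (*-identityʳ _) f0≈0)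

    ∘ₛ-self-1 : (f ∘ₛ f) 1 ≈ f 1 * f 1
    ∘ₛ-self-1 = trans (+-cong (trans (+-identityˡ _) (zeroʳ _)) (*-congˡ (powS-1 f 1))) (+-identityˡ _)

    middle : ℕ → Carrier
    middle r = sumTo r (λ i → f (2 ℕ.+ i) * powS f (2 ℕ.+ i) (2 ℕ.+ r))

    f1≈1∧f∘f≋id⇒f≋id : f 1 ≈ 1# → (f ∘ₛ f) ≋ idS → f ≋ idS
    f1≈1∧f∘f≋id⇒f≋id f1≈1 f∘f≋id = <-rec (λ n → f n ≈ idS n) step
      where
      step : ∀ n → (∀ {i} → i < n → f i ≈ idS i) → f n ≈ idS n
      step zero          _     = f0≈0
      step (suc zero)    _     = f1≈1
      step (suc (suc r)) below = x+x≈0⇒x≈0 (sym (begin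
        0#                                             ≈⟨ f∘f≋id (2 ℕ.+ r) ⟨
        (f ∘ₛ f) (2 ℕ.+ r)                             ≈⟨ ∘ₛ-split f f0≈0 r ⟩
        (f 1 * a + middle r) + a * powK (f 1) (2 ℕ.+ r)
          ≈⟨ +-cong (+-cong (trans (*-congʳ f1≈1) (*-identityˡ a))
                            (sumTo-zero r (λ i i<r → trans (*-congʳ (below (s≤s (s≤s i<r)))) (zeroˡ _))))
                    (trans (*-congˡ (powK-1 f1≈1 (2 ℕ.+ r))) (*-identityʳ a)) ⟩
        (a + 0#) + a                                   ≈⟨ +-congʳ (+-identityʳ a) ⟩
        a + a                                          ∎))
        where a = f (2 ℕ.+ r)

    module _ (f1≈-1 : f 1 ≈ - 1#) where

      f1*f1≈1 : f 1 * f 1 ≈ 1#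
      f1*f1≈1 = trans (*-cong f1≈-1 f1≈-1) -1*-1≈1

      scaled-argSeq : ∀ i → 1 ≤ i → scaled (argSeq f) i ≈ f i
      scaled-argSeq (suc zero) _ =
        trans (*-congˡ 1⁻¹≈1) (trans (*-identityʳ _) (sym f1≈-1))
        where
        1⁻¹≈1 : fromℕ 1 ⁻¹ ≈ 1#
        1⁻¹≈1 = trans (sym (*-identityˡ _)) (trans (*-congʳ (sym (+-identityʳ 1#))) (n!*n!⁻¹≈1 1))
      scaled-argSeq (suc (suc j)) _ = begin
        taylor i f * fromℕ (i !) ⁻¹            ≈⟨ *-congʳ (taylor≈n!*coefficient i f) ⟩
        (fromℕ (i !) * f i) * fromℕ (i !) ⁻¹   ≈⟨ *-congʳ (*-comm _ _) ⟩
        (f i * fromℕ (i !)) * fromℕ (i !) ⁻¹   ≈⟨ *-assoc _ _ _ ⟩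
        f i * (fromℕ (i !) * fromℕ (i !) ⁻¹)   ≈⟨ *-congˡ (n!*n!⁻¹≈1 i) ⟩
        f i * 1#                               ≈⟨ *-identityʳ _ ⟩
        f i                                    ∎
        where i = suc (suc j)

      egfSegment-argSeq : ∀ L i → i ≤ L → egfSegment (argSeq f) 1 L i ≈ f i
      egfSegment-argSeq L zero    _   = trans (egfSegment-below (argSeq f) L 1 0 (s≤s z≤n)) (sym f0≈0)
      egfSegment-argSeq L (suc i) i<L =
        trans (egfSegment-within (argSeq f) L 1 (suc i) (s≤s z≤n) (s≤s i<L)) (scaled-argSeq (suc i) (s≤s z≤n))

      Bell-argSeq : ∀ n k → k ≤ n → Bell n k (argSeq f) ≈ fromℕ (n !) * (fromℕ (k !) ⁻¹ * powS f k n)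
      Bell-argSeq n k k≤n =
        trans (Bell≈powS-egfSegment (argSeq f) n k k≤n) (*-congˡ (*-congˡ
          (powS-cong-≤ L (egfSegment-below (argSeq f) L 1 0 (s≤s z≤n)) f0≈0 (egfSegment-argSeq L) k n
            (s≤s (ℕₚ.≤-reflexive (≡.sym (ℕₚ.m∸n+n≡m k≤n)))))))
        where L = suc (n ∸ k)

      taylor*Bell-argSeq : ∀ n k → k ≤ n →
        taylor k f * Bell n k (argSeq f) ≈ fromℕ (n !) * (f k * powS f k n)
      taylor*Bell-argSeq n k k≤n = begin
        taylor k f * Bell n k (argSeq f)
          ≈⟨ *-cong (taylor≈n!*coefficient k f) (Bell-argSeq n k k≤n) ⟩
        (k! * f k) * (fromℕ (n !) * (k! ⁻¹ * powS f k n))  ≈⟨ x∙yz≈y∙xz _ _ _ ⟩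
        fromℕ (n !) * ((k! * f k) * (k! ⁻¹ * powS f k n))  ≈⟨ *-congˡ (*-interchange _ _ _ _) ⟩
        fromℕ (n !) * ((k! * k! ⁻¹) * (f k * powS f k n))  ≈⟨ *-congˡ (trans (*-congʳ (n!*n!⁻¹≈1 k)) (*-identityˡ _)) ⟩
        fromℕ (n !) * (f k * powS f k n)                   ∎
        where k! = fromℕ (k !)

      Bell-sum≈n!*middle : ∀ r → sumFromTo 2 (1 ℕ.+ r) (λ k → taylor k f * Bell (2 ℕ.+ r) k (argSeq f)) ≈
                      fromℕ ((2 ℕ.+ r) !) * middle r
      Bell-sum≈n!*middle r = trans (sumTo-cong-< r (λ i i<r → taylor*Bell-argSeq (2 ℕ.+ r) (2 ℕ.+ i) (s≤s (s≤s (ℕₚ.<⇒≤ i<r)))))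
                        (sym (*-distribˡ-sumTo r _ _))

      ∘ₛ-self-odd : ∀ k → let a = f (3 ℕ.+ 2 ℕ.* k) in
                    (f ∘ₛ f) (3 ℕ.+ 2 ℕ.* k) ≈ middle (suc (2 ℕ.* k)) + - (a + a)
      ∘ₛ-self-odd k = begin
        (f ∘ₛ f) (2 ℕ.+ r)                                ≈⟨ ∘ₛ-split f f0≈0 r ⟩
        (f 1 * a + middle r) + a * powK (f 1) (2 ℕ.+ r)
          ≈⟨ +-cong (+-congʳ (trans (*-congʳ f1≈-1) (-1*x≈-x a)))
                    (trans (*-congˡ (trans (powK-2+ f1*f1≈1 r) (trans (powK-odd f1*f1≈1 k) f1≈-1)))
                           (trans (*-comm _ _) (-1*x≈-x a))) ⟩
        (- a + middle r) + - a                            ≈⟨ +-congʳ (+-comm _ _) ⟩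
        (middle r + - a) + - a                            ≈⟨ +-assoc _ _ _ ⟩
        middle r + (- a + - a)                            ≈⟨ +-congˡ (⁻¹-∙-comm a a) ⟩
        middle r + - (a + a)                              ∎
        where
        r = suc (2 ℕ.* k)
        a = f (3 ℕ.+ 2 ℕ.* k)

      odd-coefficient : ∀ k → ((f ∘ₛ f) (3 ℕ.+ 2 ℕ.* k) ≈ 0#) ⇔ OddFormula f (3 ℕ.+ 2 ℕ.* k) (2 ℕ.+ 2 ℕ.* k)
      odd-coefficient k =
        ⇔-trans (≈-resp-⇔ (∘ₛ-self-odd k) refl)
        (⇔-trans (x-y≈0⇔x≈y (middle r) (a + a))
        (⇔-trans (y≈x+x⇔x≈half*y a (middle r))
        (⇔-trans (*-cancelˡ-⇔ (n!≉0 (2 ℕ.+ r)))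
                 (≈-resp-⇔ (sym (taylor≈n!*coefficient (2 ℕ.+ r) f))
                           (trans (x∙yz≈y∙xz _ _ _) (*-congˡ (sym (Bell-sum≈n!*middle r))))))))
        where
        r = suc (2 ℕ.* k)
        a = f (2 ℕ.+ r)

      even-coefficient : ∀ k → (∀ {i} → i < 2 ℕ.+ 2 ℕ.* k → (f ∘ₛ f) i ≈ idS i) →
                         (f ∘ₛ f) (2 ℕ.+ 2 ℕ.* k) ≈ 0#
      even-coefficient k below = -x≈x⇒x≈0 (∙-cancelʳ (f n) (- g n) (g n) (begin
        - g n + f n       ≈⟨ +-congʳ (trans (*-congʳ f1≈-1) (-1*x≈-x (g n))) ⟨
        f 1 * g n + f n   ≈⟨ f∘g≈ ⟨
        (f ∘ₛ g) n        ≈⟨ ∘ₛ-assoc f f0≈0 f0≈0 n ⟩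
        (g ∘ₛ f) n        ≈⟨ g∘f≈ ⟩
        f n + g n         ≈⟨ +-comm _ _ ⟩
        g n + f n         ∎))
        where
        r = 2 ℕ.* k
        n = 2 ℕ.+ r
        g = f ∘ₛ f
        g0≈0 : g 0 ≈ 0#
        g0≈0 = below (s≤s z≤n)
        g1≈1 : g 1 ≈ 1#
        g1≈1 = below (s≤s (s≤s z≤n))
        powS-g-middle : ∀ i → i < r → powS g (2 ℕ.+ i) n ≈ 0#
        powS-g-middle i i<r =
          trans (powS-cong-≤ (suc r) g0≈0 refl (λ j j≤1+r → below (s≤s j≤1+r)) (2 ℕ.+ i) n
                  (s≤s (ℕₚ.≤-trans (ℕₚ.≤-reflexive (ℕₚ.+-comm 2 r)) (ℕₚ.+-monoʳ-≤ r (ℕₚ.m≤m+n 2 i)))))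
                (powS-idS-off-diagonal (2 ℕ.+ i) n
                  (λ n≡2+i → ℕₚ.<-irrefl (≡.sym (ℕₚ.+-cancelˡ-≡ 2 r i n≡2+i)) i<r))
        f∘g≈ : (f ∘ₛ g) n ≈ f 1 * g n + f n
        f∘g≈ = trans (∘ₛ-split f g0≈0 r)
          (+-cong (trans (+-congˡ (sumTo-zero r (λ i i<r → trans (*-congˡ (powS-g-middle i i<r)) (zeroʳ _))))
                         (+-identityʳ _))
                  (trans (*-congˡ (powK-1 g1≈1 n)) (*-identityʳ _)))
        g∘f≈ : (g ∘ₛ f) n ≈ f n + g n
        g∘f≈ = trans (∘ₛ-split g f0≈0 r)
          (+-cong (trans (+-cong (trans (*-congʳ g1≈1) (*-identityˡ _))
                                 (sumTo-zero r (λ i i<r → trans (*-congʳ (below (s≤s (s≤s i<r)))) (zeroˡ _))))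
                         (+-identityʳ _))
                  (trans (*-congˡ (trans (powK-2+ f1*f1≈1 r) (powK-even f1*f1≈1 k))) (*-identityʳ _)))

  OddFormula-reindex : ∀ f k → OddFormula f (3 ℕ.+ 2 ℕ.* k) (2 ℕ.+ 2 ℕ.* k) ⇔
                               OddFormula f (2 ℕ.* suc k ℕ.+ 1) (2 ℕ.* suc k)
  OddFormula-reindex f k = mk⇔
    (≡.subst₂ (OddFormula f) (≡.sym (2[1+k]+1≡3+2k k)) (≡.sym (ℕₚ.*-suc 2 k)))
    (≡.subst₂ (OddFormula f) (2[1+k]+1≡3+2k k) (ℕₚ.*-suc 2 k))

  involution⇒formula : ∀ f → Invertible f → ¬ (f ≋ idS) → (f ∘ₛ f) ≋ idS → CoefficientFormula f
  involution⇒formula f (f0≈0 , _) f≉id f∘f≋id =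
    (λ m → taylor (2 ℕ.* m) f) , trans (taylor-1 f) f1≈-1 , (λ _ _ → refl) , odd
    where
    f1≈-1 : f 1 ≈ - 1#
    f1≈-1 = x*x≈1∧x≉1⇒x≈-1 (trans (sym (∘ₛ-self-1 f f0≈0)) (f∘f≋id 1))
              (λ f1≈1 → f≉id (f1≈1∧f∘f≋id⇒f≋id f f0≈0 f1≈1 f∘f≋id))
    odd : ∀ m → 1 ≤ m → OddFormula f (2 ℕ.* m ℕ.+ 1) (2 ℕ.* m)
    odd (suc k) _ = Equivalence.to (OddFormula-reindex f k)
      (Equivalence.to (odd-coefficient f f0≈0 f1≈-1 k) (f∘f≋id (3 ℕ.+ 2 ℕ.* k)))

  -- The even-degree coefficients are unconstrained, so that part of the formula is not needed.
  formula⇒involution : ∀ f → Invertible f → CoefficientFormula f → (f ∘ₛ f) ≋ idS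
  formula⇒involution f (f0≈0 , _) (_ , taylor1≈-1 , _ , odd) = <-rec (λ n → (f ∘ₛ f) n ≈ idS n) step
    where
    f1≈-1 : f 1 ≈ - 1#
    f1≈-1 = trans (sym (taylor-1 f)) taylor1≈-1
    step : ∀ n → (∀ {i} → i < n → (f ∘ₛ f) i ≈ idS i) → (f ∘ₛ f) n ≈ idS n
    step zero          _     = ∘ₛ-self-0 f f0≈0
    step (suc zero)    _     = trans (∘ₛ-self-1 f f0≈0) (f1*f1≈1 f f0≈0 f1≈-1)
    step (suc (suc r)) below with even⊎odd r
    ... | inj₁ (k , ≡.refl) = even-coefficient f f0≈0 f1≈-1 k below
    ... | inj₂ (k , ≡.refl) = Equivalence.from (odd-coefficient f f0≈0 f1≈-1 k)
                                (Equivalence.from (OddFormula-reindex f k) (odd (suc k) (s≤s z≤n)))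

theorem2p1 : {c ℓ : Level} (K : CharZeroField c ℓ) →
  let open CharZeroField K hiding (zero)
      open PowerSeries K
  in (f : Series) → Invertible f → ¬ (f ≋ idS) →
     ((f ∘ₛ f) ≋ idS →
        Σ (ℕ → Carrier) λ a →
          (taylor 1 f ≈ - 1#)
          × (∀ m → 1 ≤ m → taylor (2 ℕ.* m) f ≈ a m)
          × (∀ m → 1 ≤ m → taylor (2 ℕ.* m ℕ.+ 1) f ≈
               half * sumFromTo 2 (2 ℕ.* m)
                        (λ k → taylor k f * Bell (2 ℕ.* m ℕ.+ 1) k (argSeq f))))
     × (Σ (ℕ → Carrier) (λ a →
          (taylor 1 f ≈ - 1#)
          × (∀ m → 1 ≤ m → taylor (2 ℕ.* m) f ≈ a m)
          × (∀ m → 1 ≤ m → taylor (2 ℕ.* m ℕ.+ 1) f ≈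
               half * sumFromTo 2 (2 ℕ.* m)
                        (λ k → taylor k f * Bell (2 ℕ.* m ℕ.+ 1) k (argSeq f))))
        → (f ∘ₛ f) ≋ idS)
theorem2p1 K f invertible f≉id =
  Involution.involution⇒formula K f invertible f≉id , Involution.formula⇒involution K f invertible
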